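{- Let $p\neq q$ be primes, let $\mathbf P$ be a finite abelian $p$-group and $\mathbf Q$ a finite abelian $q$-group, and let $\mathbf G=\mathbf P\times\mathbf Q$. Let $H$ be a complete bipartite subgraph of $\mathcal D(\mathbf G)$ with partite sets $X$ and $Y$ (so $X$ and $Y$ are independent sets in $\mathcal D(\mathbf G)$ and every vertex of $X$ is adjacent to every vertex of $Y$). Suppose $(a_1,b_1)\in X$ and $(c_1,d_1)\in Y$ satisfy $c_1\twoheadrightarrow a_1$ and $b_1\twoheadrightarrow d_1$. Then for all $(a,b)\in X$ and $(c,d)\in Y$ we have $c\twoheadrightarrow a$ and $b\twoheadrightarrow d$.
   Context: For elements $x,y$ of a group, $x\twoheadrightarrow y$ means that $y\in\langle x\rangle$ but $x\notin\langle y\rangle$. The power graph of a group $\mathbf K$ is the simple graph on $K$ in which two distinct elements are adjacent iff one is a power of the other; the enhanced power graph of $\mathbf K$ is the simple graph on $K$ in which two distinct elements are adjacent iff they generate a cyclic subgroup. The difference graph $\mathcal D(\mathbf K)$ is the graph whose edges are the pairs adjacent in the enhanced power graph but not in the power graph, with all isolated vertices removed. -}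

module Defs where

open import Level using (Level; _⊔_)
open import Data.Nat using (ℕ; zero; suc; _^_)
open import Data.Nat.Primality using (Prime)
open import Data.Integer using (ℤ; +_; -[1+_])
open import Data.Fin using (Fin)
open import Data.Product using (Σ; ∃; _×_; _,_)
open import Data.Sum using (_⊎_)
open import Relation.Nullary using (¬_)
open import Relation.Binary.PropositionalEquality as ≡ using (_≡_)
open import Algebra.Bundles using (Group; AbelianGroup)
open import Function.Bundles using (Bijection)
import Algebra.Construct.DirectProduct as DP

module _ {c ℓ : Level} (G : Group c ℓ) where
  open Group G

  powℕ : Carrier → ℕ → Carrier
  powℕ x zero    = ε
  powℕ x (suc n) = x ∙ powℕ x n

  powℤ : Carrier → ℤ → Carrier
  powℤ x (+ n)      = powℕ x n
  powℤ x -[1+ n ]   = (powℕ x (suc n)) ⁻¹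

  InCyc : Carrier → Carrier → Set ℓ
  InCyc y x = ∃ λ (z : ℤ) → y ≈ powℤ x z

  Dominates : Carrier → Carrier → Set ℓ
  Dominates x y = InCyc y x × ¬ InCyc x y

  PowAdj : Carrier → Carrier → Set ℓ
  PowAdj x y = ¬ (x ≈ y) × (InCyc x y ⊎ InCyc y x)

  -- adjacency in the enhanced power graph: ⟨x , y⟩ is cyclic
  EnhAdj : Carrier → Carrier → Set (c ⊔ ℓ)
  EnhAdj x y = ¬ (x ≈ y) × (∃ λ g → InCyc x g × InCyc y g)

  DiffAdj : Carrier → Carrier → Set (c ⊔ ℓ)
  DiffAdj x y = EnhAdj x y × ¬ PowAdj x y

  -- vertices of D(G): non-isolated elements
  DiffVertex : Carrier → Set (c ⊔ ℓ)
  DiffVertex x = ∃ λ y → DiffAdj x y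

  record CompleteBipartiteSub {r} (X Y : Carrier → Set r) : Set (c ⊔ ℓ ⊔ r) where
    field
      X⊆V   : ∀ x → X x → DiffVertex x
      Y⊆V   : ∀ y → Y y → DiffVertex y
      X-ind : ∀ x x′ → X x → X x′ → ¬ DiffAdj x x′
      Y-ind : ∀ y y′ → Y y → Y y′ → ¬ DiffAdj y y′
      XY    : ∀ x y → X x → Y y → DiffAdj x y

-- A finite p-group: its order is a power of p, i.e. a setoid bijection
-- between Fin (p ^ k) and the carrier, for some k.
IsFinitePGroup : {c ℓ : Level} → ℕ → AbelianGroup c ℓ → Set (c ⊔ ℓ)
IsFinitePGroup p A =
  ∃ λ (k : ℕ) → Bijection (≡.setoid (Fin (p ^ k))) (AbelianGroup.setoid A)

_×ᴳ_ : {c ℓ : Level} → AbelianGroup c ℓ → AbelianGroup c ℓ → AbelianGroup c ℓ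
P ×ᴳ Q = DP.abelianGroup P Q

-- A finite abelian p-group has exponent p^K (Lagrange), so the subgroups of each of its cyclic
-- subgroups form a chain, as the divisors of p^K do. Since p ≠ q, an
-- element (a, b) of P × Q is a power of (c, d) iff a is a power of c and b a power of d (Chinese
-- remainder theorem). Hence two elements of a common cyclic subgroup that are not powers of each other
-- are ordered strictly in opposite directions in the two coordinates: the edges of D(P × Q) are exactly
-- the comparable pairs of the transitive relation (a, b) ⋈ (c, d) :⇔ c ↠ a and b ↠ d. In a complete
-- bipartite subgraph with independent sides, an edge y ⋈ x together with x₁ ⋈ y₁ would produce, via
-- x₁ ⋈ y or y ⋈ x₁, an edge inside X or inside Y.

module Submission where

open import Defs
open import Level using (0ℓ; _⊔_)
open import Data.Nat using (ℕ; zero; suc; _+_; _*_; pred; NonZero)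
import Data.Nat as ℕ
open import Data.Nat.Properties using (*-comm; suc-pred; m^n≢0; m*n≢0)
open import Data.Nat.Divisibility using (_∣_; divides; _∣?_; ∣-trans; 1∣_; ∣1⇒≡1; *-monoˡ-∣; *-cancelʳ-∣)
open import Data.Nat.GCD using (gcd; gcd-GCD; gcd[m,n]∣m; gcd[m,n]∣n; module Bézout)
open import Data.Nat.Coprimality using (Coprime; coprime-divisor; coprime-Bézout)
open import Data.Nat.Primality using (Prime; prime⇒irreducible; prime⇒nonZero; ¬prime[1])
open import Data.Integer using (+_; -[1+_])
open import Data.Fin using (Fin)
open import Data.Fin.Permutation using (Permutation; permutation)
open import Data.Vec.Functional using (replicate)
open import Data.Product using (∃; _×_; _,_; proj₁; proj₂)
open import Data.Sum using (_⊎_; inj₁; inj₂)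
import Data.Sum as Sum
open import Data.Empty using (⊥-elim)
open import Function using (_∘_)
open import Function.Bundles using (Bijection; module Surjection)
open import Relation.Nullary using (¬_; yes; no)
open import Relation.Binary.Core using (Rel)
open import Relation.Binary.Definitions using (Transitive)
open import Relation.Binary.PropositionalEquality using (_≡_; refl; cong; subst)
import Relation.Binary.PropositionalEquality as ≡
open import Algebra.Bundles using (Group; AbelianGroup)
import Algebra.Construct.DirectProduct as DirectProduct

complete-bipartite-oriented :
  ∀ {v r e s} {V : Set v} {R : Rel V r} {E : Rel V e} {X Y : V → Set s} →
  Transitive R → (∀ {x y} → E x y → R x y ⊎ R y x) → (∀ {x y} → R x y → E x y) →
  (∀ x x′ → X x → X x′ → ¬ E x x′) → (∀ y y′ → Y y → Y y′ → ¬ E y y′) →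
  (∀ x y → X x → Y y → E x y) →
  ∀ {x₀ y₀} → X x₀ → Y y₀ → R x₀ y₀ → ∀ {x y} → X x → Y y → R x y
complete-bipartite-oriented R-trans E⇒R R⇒E X-ind Y-ind XY {x₀} {y₀} x₀∈X y₀∈Y x₀<y₀ {x} {y} x∈X y∈Y
  with E⇒R (XY x y x∈X y∈Y)
... | inj₁ x<y = x<y
... | inj₂ y<x with E⇒R (XY x₀ y x₀∈X y∈Y)
...   | inj₁ x₀<y = ⊥-elim (X-ind x₀ x x₀∈X x∈X (R⇒E (R-trans x₀<y y<x)))
...   | inj₂ y<x₀ = ⊥-elim (Y-ind y y₀ y∈Y y₀∈Y (R⇒E (R-trans y<x₀ x₀<y₀)))

module PrimePowerDivisors {p : ℕ} (p-prime : Prime p) where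

  ∤⇒coprime : ∀ {d} → ¬ p ∣ d → Coprime d p
  ∤⇒coprime p∤d (i∣d , i∣p) with prime⇒irreducible p-prime i∣p
  ... | inj₁ i≡1 = i≡1
  ... | inj₂ refl = ⊥-elim (p∤d i∣d)

  ∤∧∣^⇒∣1 : ∀ K {d} → ¬ p ∣ d → d ∣ p ℕ.^ K → d ∣ 1
  ∤∧∣^⇒∣1 zero    p∤d d∣1 = d∣1
  ∤∧∣^⇒∣1 (suc K) p∤d d∣p^1+K = ∤∧∣^⇒∣1 K p∤d (coprime-divisor (∤⇒coprime p∤d) d∣p^1+K)

  ∣^-total : ∀ K {d e} → d ∣ p ℕ.^ K → e ∣ p ℕ.^ K → d ∣ e ⊎ e ∣ d
  ∣^-total zero    d∣1 _ = inj₁ (∣-trans d∣1 (1∣ _))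
  ∣^-total (suc K) {d} {e} d∣p^1+K e∣p^1+K with p ∣? d | p ∣? e
  ... | no p∤d | _      = inj₁ (∣-trans (∤∧∣^⇒∣1 (suc K) p∤d d∣p^1+K) (1∣ e))
  ... | yes _  | no p∤e = inj₂ (∣-trans (∤∧∣^⇒∣1 (suc K) p∤e e∣p^1+K) (1∣ d))
  ... | yes (divides d′ refl) | yes (divides e′ refl) =
    Sum.map (*-monoˡ-∣ p) (*-monoˡ-∣ p) (∣^-total K (cancel {d′} d∣p^1+K) (cancel {e′} e∣p^1+K))
    where
    instance _ = prime⇒nonZero p-prime
    cancel : ∀ {m} → m * p ∣ p * p ℕ.^ K → m ∣ p ℕ.^ K
    cancel {m} h = *-cancelʳ-∣ p (subst (m * p ∣_) (*-comm p (p ℕ.^ K)) h)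

coprime-prime^ : ∀ {p q} → Prime p → Prime q → ¬ p ≡ q → ∀ K L → Coprime (p ℕ.^ K) (q ℕ.^ L)
coprime-prime^ {p} {q} p-prime q-prime p≢q K L {i} (i∣p^K , i∣q^L) with p ∣? i
... | no p∤i = ∣1⇒≡1 (PrimePowerDivisors.∤∧∣^⇒∣1 p-prime K p∤i i∣p^K)
... | yes p∣i = ⊥-elim (¬prime[1] (subst Prime (∣1⇒≡1 p∣1) p-prime))
  where
  q∤p : ¬ q ∣ p
  q∤p q∣p with prime⇒irreducible p-prime q∣p
  ... | inj₁ refl = ¬prime[1] q-prime
  ... | inj₂ refl = p≢q refl
  p∣1 : p ∣ 1
  p∣1 = PrimePowerDivisors.∤∧∣^⇒∣1 q-prime L q∤p (∣-trans p∣i i∣q^L)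

module CyclicSubgroups {c ℓ} (G : Group c ℓ) where

  open Group G renaming (refl to ≈-refl)
  open import Algebra.Properties.Group G using (inverseˡ-unique; inverseʳ-unique)
  open import Algebra.Properties.Monoid.Mult monoid using (×-congʳ; ×-congˡ; ×-homo-1; ×-homo-+; ×-assocˡ)
    renaming (_×_ to _×ⁿ_)
  open import Algebra.Properties.Monoid.Sum monoid using (sum-replicate; sum-replicate-zero)
  open import Relation.Binary.Reasoning.Setoid setoid

  infixl 9 _^_
  _^_ : Carrier → ℕ → Carrier
  x ^ n = n ×ⁿ x

  -- Natural exponents suffice once the group has an exponent (InCyc⇒∈⟨⟩ below).
  infix 4 _∈⟨_⟩ _↠_
  _∈⟨_⟩ : Carrier → Carrier → Set ℓ
  y ∈⟨ x ⟩ = ∃ λ n → y ≈ x ^ n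

  _↠_ : Carrier → Carrier → Set ℓ
  x ↠ y = y ∈⟨ x ⟩ × ¬ x ∈⟨ y ⟩

  HasExponent : ℕ → Set (c ⊔ ℓ)
  HasExponent M = ∀ x → x ^ M ≈ ε

  CyclicSubgroupsAreChains : Set (c ⊔ ℓ)
  CyclicSubgroupsAreChains = ∀ {g y z} → y ∈⟨ g ⟩ → z ∈⟨ g ⟩ → y ∈⟨ z ⟩ ⊎ z ∈⟨ y ⟩

  ε^n≈ε : ∀ n → ε ^ n ≈ ε
  ε^n≈ε n = trans (sym (sum-replicate n)) (sum-replicate-zero n)

  powℕ≡^ : ∀ x n → powℕ G x n ≡ x ^ n
  powℕ≡^ x zero    = refl
  powℕ≡^ x (suc n) = cong (x ∙_) (powℕ≡^ x n)

  ^-∈⟨⟩ : ∀ x n → x ^ n ∈⟨ x ⟩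
  ^-∈⟨⟩ x n = n , ≈-refl

  ∈⟨⟩-refl : ∀ x → x ∈⟨ x ⟩
  ∈⟨⟩-refl x = 1 , sym (×-homo-1 x)

  ∈⟨⟩-trans : ∀ {x y z} → z ∈⟨ y ⟩ → y ∈⟨ x ⟩ → z ∈⟨ x ⟩
  ∈⟨⟩-trans {x} (m , z≈y^m) (n , y≈x^n) = m * n , trans z≈y^m (trans (×-congʳ m y≈x^n) (×-assocˡ x m n))

  ∈⟨⟩-respˡ : ∀ {x y y′} → y ≈ y′ → y ∈⟨ x ⟩ → y′ ∈⟨ x ⟩
  ∈⟨⟩-respˡ y≈y′ (n , y≈x^n) = n , trans (sym y≈y′) y≈x^n

  ∈⟨⟩-respʳ : ∀ {x x′ y} → x ≈ x′ → y ∈⟨ x ⟩ → y ∈⟨ x′ ⟩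
  ∈⟨⟩-respʳ x≈x′ (n , y≈x^n) = n , trans y≈x^n (×-congʳ n x≈x′)

  ∙-∈⟨⟩ : ∀ {x y z} → y ∈⟨ x ⟩ → z ∈⟨ x ⟩ → y ∙ z ∈⟨ x ⟩
  ∙-∈⟨⟩ {x} (m , y≈x^m) (n , z≈x^n) = m + n , trans (∙-cong y≈x^m z≈x^n) (sym (×-homo-+ x m n))

  ∣⇒^∈⟨^⟩ : ∀ x {d m} → d ∣ m → x ^ m ∈⟨ x ^ d ⟩
  ∣⇒^∈⟨^⟩ x {d} (divides k refl) = k , sym (×-assocˡ x k d)

  ∈⟨⟩⇒InCyc : ∀ {x y} → y ∈⟨ x ⟩ → InCyc G y x
  ∈⟨⟩⇒InCyc {x} (n , y≈x^n) = + n , trans y≈x^n (reflexive (≡.sym (powℕ≡^ x n)))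

  ↠-trans : ∀ {x y z} → x ↠ y → y ↠ z → x ↠ z
  ↠-trans (y∈⟨x⟩ , x∉⟨y⟩) (z∈⟨y⟩ , y∉⟨z⟩) =
    ∈⟨⟩-trans z∈⟨y⟩ y∈⟨x⟩ , λ x∈⟨z⟩ → y∉⟨z⟩ (∈⟨⟩-trans y∈⟨x⟩ x∈⟨z⟩)

  module Exponent {M : ℕ} {{_ : NonZero M}} (exponent : HasExponent M) where

    ^-multiple≈ε : ∀ k x → x ^ (k * M) ≈ ε
    ^-multiple≈ε k x = begin
      x ^ (k * M)  ≈⟨ ×-assocˡ x k M ⟨
      (x ^ M) ^ k  ≈⟨ ×-congʳ k (exponent x) ⟩
      ε ^ k        ≈⟨ ε^n≈ε k ⟩
      ε            ∎

    ⁻¹≈^pred : ∀ x → x ⁻¹ ≈ x ^ pred M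
    ⁻¹≈^pred x = sym (inverseʳ-unique x (x ^ pred M) (trans (×-congˡ (suc-pred M)) (exponent x)))

    ⁻¹-∈⟨⟩ : ∀ {x y} → y ∈⟨ x ⟩ → y ⁻¹ ∈⟨ x ⟩
    ⁻¹-∈⟨⟩ {y = y} = ∈⟨⟩-trans (pred M , ⁻¹≈^pred y)

    InCyc⇒∈⟨⟩ : ∀ {x y} → InCyc G y x → y ∈⟨ x ⟩
    InCyc⇒∈⟨⟩ {x} (+ n      , y≈x^n) = n , trans y≈x^n (reflexive (powℕ≡^ x n))
    InCyc⇒∈⟨⟩ {x} (-[1+ n ] , y≈x^-n) =
      ∈⟨⟩-respˡ (sym (trans y≈x^-n (⁻¹-cong (reflexive (powℕ≡^ x (suc n))))))
                (⁻¹-∈⟨⟩ (^-∈⟨⟩ x (suc n)))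

    Dominates⇒↠ : ∀ {x y} → Dominates G x y → x ↠ y
    Dominates⇒↠ (y∈⟨x⟩ , x∉⟨y⟩) = InCyc⇒∈⟨⟩ y∈⟨x⟩ , x∉⟨y⟩ ∘ ∈⟨⟩⇒InCyc

    ↠⇒Dominates : ∀ {x y} → x ↠ y → Dominates G x y
    ↠⇒Dominates (y∈⟨x⟩ , x∉⟨y⟩) = ∈⟨⟩⇒InCyc y∈⟨x⟩ , x∉⟨y⟩ ∘ InCyc⇒∈⟨⟩

    -- By Bézout gcd m M ≡ ± u m modulo M; the sign − is absorbed by ⁻¹-∈⟨⟩.
    ^gcd-∈⟨^⟩ : ∀ x m → x ^ gcd m M ∈⟨ x ^ m ⟩
    ^gcd-∈⟨^⟩ x m with Bézout.identity (gcd-GCD m M)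
    ... | Bézout.+- u v d+vM≡um = u , (begin
      x ^ d                ≈⟨ identityʳ _ ⟨
      x ^ d ∙ ε            ≈⟨ ∙-congˡ (^-multiple≈ε v x) ⟨
      x ^ d ∙ x ^ (v * M)  ≈⟨ ×-homo-+ x d (v * M) ⟨
      x ^ (d + v * M)      ≈⟨ ×-congˡ d+vM≡um ⟩
      x ^ (u * m)          ≈⟨ ×-assocˡ x u m ⟨
      x ^ m ^ u            ∎)
      where d = gcd m M
    ... | Bézout.-+ u v d+um≡vM =
      ∈⟨⟩-respˡ (sym (inverseˡ-unique (x ^ d) (x ^ m ^ u) x^d∙x^m^u≈ε)) (⁻¹-∈⟨⟩ (^-∈⟨⟩ (x ^ m) u))
      where
      d = gcd m M
      x^d∙x^m^u≈ε : x ^ d ∙ x ^ m ^ u ≈ ε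
      x^d∙x^m^u≈ε = begin
        x ^ d ∙ x ^ m ^ u    ≈⟨ ∙-congˡ (×-assocˡ x u m) ⟩
        x ^ d ∙ x ^ (u * m)  ≈⟨ ×-homo-+ x d (u * m) ⟨
        x ^ (d + u * m)      ≈⟨ ×-congˡ d+um≡vM ⟩
        x ^ (v * M)          ≈⟨ ^-multiple≈ε v x ⟩
        ε                    ∎

    gcd∣gcd⇒^∈⟨^⟩ : ∀ x m n → gcd m M ∣ gcd n M → x ^ n ∈⟨ x ^ m ⟩
    gcd∣gcd⇒^∈⟨^⟩ x m n gcd∣gcd =
      ∈⟨⟩-trans (∈⟨⟩-trans (∣⇒^∈⟨^⟩ x (gcd[m,n]∣m n M)) (∣⇒^∈⟨^⟩ x gcd∣gcd)) (^gcd-∈⟨^⟩ x m)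

    divisor-chain⇒CyclicSubgroupsAreChains :
      (∀ {d e} → d ∣ M → e ∣ M → d ∣ e ⊎ e ∣ d) → CyclicSubgroupsAreChains
    divisor-chain⇒CyclicSubgroupsAreChains chain {g} (m , y≈g^m) (n , z≈g^n)
      with chain (gcd[m,n]∣n m M) (gcd[m,n]∣n n M)
    ... | inj₁ h = inj₂ (∈⟨⟩-respʳ (sym y≈g^m) (∈⟨⟩-respˡ (sym z≈g^n) (gcd∣gcd⇒^∈⟨^⟩ g m n h)))
    ... | inj₂ h = inj₁ (∈⟨⟩-respʳ (sym z≈g^n) (∈⟨⟩-respˡ (sym y≈g^m) (gcd∣gcd⇒^∈⟨^⟩ g n m h)))

module _ {c ℓ} (A : AbelianGroup c ℓ) {N : ℕ}
         (enumeration : Bijection (≡.setoid (Fin N)) (AbelianGroup.setoid A)) where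

  open AbelianGroup A
  open CyclicSubgroups group using (_^_; HasExponent)
  open import Algebra.Properties.Group group using (identityˡ-unique)
  open import Algebra.Properties.CommutativeMonoid.Sum commutativeMonoid
    using (sum; ∑-distrib-+; sum-cong-≋; sum-permute; sum-replicate)
  open Bijection enumeration using (to; injective; surjection)
  open Surjection surjection using (to⁻; to∘to⁻)
  open import Relation.Binary.Reasoning.Setoid setoid

  private
    translate : Carrier → Fin N → Fin N
    translate x i = to⁻ (x ∙ to i)

    translate-cancel : ∀ {x y} → x ∙ y ≈ ε → ∀ i → translate x (translate y i) ≡ i
    translate-cancel {x} {y} x∙y≈ε i = injective (begin
      to (translate x (translate y i)) ≈⟨ to∘to⁻ _ ⟩
      x ∙ to (translate y i)           ≈⟨ ∙-congˡ (to∘to⁻ _) ⟩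
      x ∙ (y ∙ to i)                   ≈⟨ assoc x y (to i) ⟨
      x ∙ y ∙ to i                     ≈⟨ ∙-congʳ x∙y≈ε ⟩
      ε ∙ to i                         ≈⟨ identityˡ (to i) ⟩
      to i                             ∎)

    translation : Carrier → Permutation N N
    translation x = permutation (translate x) (translate (x ⁻¹))
                      (translate-cancel (inverseʳ x)) (translate-cancel (inverseˡ x))

  -- Translation by x permutes the elements, so x ^ N ∙ Σ A ≈ Σ A.
  card-exponent : HasExponent N
  card-exponent x = identityˡ-unique (x ^ N) (sum to) (begin
    x ^ N ∙ sum to                  ≈⟨ ∙-congʳ (sum-replicate N) ⟨
    sum (replicate N x) ∙ sum to    ≈⟨ ∑-distrib-+ (replicate N x) to ⟨
    sum (λ i → x ∙ to i)            ≈⟨ sum-cong-≋ (λ i → to∘to⁻ (x ∙ to i)) ⟨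
    sum (to ∘ translate x)          ≈⟨ sum-permute to (translation x) ⟨
    sum to                          ∎)

module FiniteAbelianPGroup {c ℓ} {p : ℕ} (p-prime : Prime p) (A : AbelianGroup c ℓ)
                           (A-finite : IsFinitePGroup p A) where

  open AbelianGroup A using (group)
  open CyclicSubgroups group

  K : ℕ
  K = proj₁ A-finite

  instance
    p^K≢0 : NonZero (p ℕ.^ K)
    p^K≢0 = m^n≢0 p K {{prime⇒nonZero p-prime}}

  exponent : HasExponent (p ℕ.^ K)
  exponent = card-exponent A (proj₂ A-finite)

  open Exponent exponent public

  cyclicSubgroupsAreChains : CyclicSubgroupsAreChains
  cyclicSubgroupsAreChains = divisor-chain⇒CyclicSubgroupsAreChains (PrimePowerDivisors.∣^-total p-prime K)

module CoprimeProduct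
  {a ℓa b ℓb} (A : Group a ℓa) (B : Group b ℓb) {M N : ℕ} {{_ : NonZero M}} {{_ : NonZero N}}
  (A-exponent : CyclicSubgroups.HasExponent A M) (B-exponent : CyclicSubgroups.HasExponent B N)
  (M⊥N : Coprime M N) where

  module A where
    open Group A public
    open import Algebra.Properties.Group A public using (inverseʳ-unique)
    open CyclicSubgroups A public
    open Exponent A-exponent public

  module B where
    open Group B public
    open import Algebra.Properties.Group B public using (ε⁻¹≈ε)
    open CyclicSubgroups B public
    open Exponent B-exponent public

  G : Group (a ⊔ b) (ℓa ⊔ ℓb)
  G = DirectProduct.group A B

  open Group G renaming (refl to ≈-refl)
  open import Algebra.Properties.Group G using (⁻¹-involutive)
  open CyclicSubgroups G

  ^-pair : ∀ {g h} n → (g , h) ^ n ≈ (g A.^ n , h B.^ n)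
  ^-pair zero    = ≈-refl
  ^-pair (suc n) = ∙-congˡ (^-pair n)

  instance
    M*N≢0 : NonZero (M * N)
    M*N≢0 = m*n≢0 M N

  G-exponent : HasExponent (M * N)
  G-exponent (g , h) = trans (^-pair (M * N))
    ( A.trans (A.reflexive (cong (g A.^_) (*-comm M N))) (A.^-multiple≈ε N g)
    , B.^-multiple≈ε M h)

  open Exponent G-exponent

  ∈⟨⟩-proj : ∀ {a b g h} → (a , b) ∈⟨ (g , h) ⟩ → a A.∈⟨ g ⟩ × b B.∈⟨ h ⟩
  ∈⟨⟩-proj (n , ab≈gh^n) = let ab≈ = trans ab≈gh^n (^-pair n) in (n , proj₁ ab≈) , (n , proj₂ ab≈)

  -- By Bézout some multiple v N is ≡ ± 1 modulo M; the sign − is absorbed by ⁻¹-∈⟨⟩.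
  left-∈⟨⟩ : ∀ g h → (g , B.ε) ∈⟨ (g , h) ⟩
  left-∈⟨⟩ g h with coprime-Bézout M⊥N
  ... | Bézout.-+ u v 1+uM≡vN = v * N , sym (trans (^-pair (v * N)) (g^vN≈g , B.^-multiple≈ε v h))
    where
    g^vN≈g : g A.^ (v * N) A.≈ g
    g^vN≈g = A.trans (A.reflexive (cong (g A.^_) (≡.sym 1+uM≡vN)))
               (A.trans (A.∙-congˡ (A.^-multiple≈ε u g)) (A.identityʳ g))
  ... | Bézout.+- u v 1+vN≡uM =
    ∈⟨⟩-respˡ (⁻¹-involutive (g , B.ε))
      (⁻¹-∈⟨⟩ (v * N , trans (A.sym g^vN≈g⁻¹ , B.trans B.ε⁻¹≈ε (B.sym (B.^-multiple≈ε v h)))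
                             (sym (^-pair (v * N)))))
    where
    g^vN≈g⁻¹ : g A.^ (v * N) A.≈ g A.⁻¹
    g^vN≈g⁻¹ = A.inverseʳ-unique g (g A.^ (v * N))
                 (A.trans (A.reflexive (cong (g A.^_) 1+vN≡uM)) (A.^-multiple≈ε u g))

  right-∈⟨⟩ : ∀ g h → (A.ε , h) ∈⟨ (g , h) ⟩
  right-∈⟨⟩ g h =
    ∈⟨⟩-respˡ (A.inverseˡ g , B.trans (B.∙-congʳ B.ε⁻¹≈ε) (B.identityˡ h))
      (∙-∈⟨⟩ (⁻¹-∈⟨⟩ (left-∈⟨⟩ g h)) (∈⟨⟩-refl (g , h)))

  ∈⟨⟩-pair : ∀ {a b g h} → a A.∈⟨ g ⟩ → b B.∈⟨ h ⟩ → (a , b) ∈⟨ (g , h) ⟩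
  ∈⟨⟩-pair {a} {b} {g} {h} (m , a≈g^m) (n , b≈h^n) =
    ∈⟨⟩-respˡ g^m∙h^n≈ab
      (∙-∈⟨⟩ (∈⟨⟩-trans (^-∈⟨⟩ _ m) (left-∈⟨⟩ g h)) (∈⟨⟩-trans (^-∈⟨⟩ _ n) (right-∈⟨⟩ g h)))
    where
    g^m∙h^n≈ab : (g , B.ε) ^ m ∙ (A.ε , h) ^ n ≈ (a , b)
    g^m∙h^n≈ab = trans (∙-cong (^-pair m) (^-pair n))
      ( A.trans (A.∙-congˡ (A.ε^n≈ε n)) (A.trans (A.identityʳ _) (A.sym a≈g^m))
      , B.trans (B.∙-congʳ (B.ε^n≈ε m)) (B.trans (B.identityˡ _) (B.sym b≈h^n)))

  infix 4 _⋈_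
  _⋈_ : Rel Carrier (ℓa ⊔ ℓb)
  (a , b) ⋈ (c , d) = c A.↠ a × b B.↠ d

  ⋈-trans : Transitive _⋈_
  ⋈-trans (c↠a , b↠d) (e↠c , d↠f) = A.↠-trans e↠c c↠a , B.↠-trans b↠d d↠f

  ⋈⇒DiffAdj : ∀ {x y} → x ⋈ y → DiffAdj G x y
  ⋈⇒DiffAdj {a , b} {c , d} ((a∈⟨c⟩ , c∉⟨a⟩) , (d∈⟨b⟩ , b∉⟨d⟩)) =
    ( ab≉cd
    , (c , b) , ∈⟨⟩⇒InCyc (∈⟨⟩-pair a∈⟨c⟩ (B.∈⟨⟩-refl b)) , ∈⟨⟩⇒InCyc (∈⟨⟩-pair (A.∈⟨⟩-refl c) d∈⟨b⟩))
    , λ { (_ , inj₁ ab∈⟨cd⟩) → b∉⟨d⟩ (proj₂ (∈⟨⟩-proj (InCyc⇒∈⟨⟩ ab∈⟨cd⟩)))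
        ; (_ , inj₂ cd∈⟨ab⟩) → c∉⟨a⟩ (proj₁ (∈⟨⟩-proj (InCyc⇒∈⟨⟩ cd∈⟨ab⟩))) }
    where
    ab≉cd : ¬ (a , b) ≈ (c , d)
    ab≉cd (a≈c , _) = c∉⟨a⟩ (A.∈⟨⟩-respˡ a≈c (A.∈⟨⟩-refl a))

  crossing⇒⋈ : ∀ {a b c d} → a A.∈⟨ c ⟩ → d B.∈⟨ b ⟩ →
               ¬ ((a , b) ∈⟨ (c , d) ⟩ ⊎ (c , d) ∈⟨ (a , b) ⟩) → (a , b) ⋈ (c , d)
  crossing⇒⋈ a∈⟨c⟩ d∈⟨b⟩ incomparable =
    (a∈⟨c⟩ , λ c∈⟨a⟩ → incomparable (inj₂ (∈⟨⟩-pair c∈⟨a⟩ d∈⟨b⟩))) ,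
    (d∈⟨b⟩ , λ b∈⟨d⟩ → incomparable (inj₁ (∈⟨⟩-pair a∈⟨c⟩ b∈⟨d⟩)))

  module _ (A-chains : A.CyclicSubgroupsAreChains) (B-chains : B.CyclicSubgroupsAreChains) where

    incomparable⇒⋈ : ∀ {a b c d g h} → a A.∈⟨ g ⟩ × b B.∈⟨ h ⟩ → c A.∈⟨ g ⟩ × d B.∈⟨ h ⟩ →
                     ¬ ((a , b) ∈⟨ (c , d) ⟩ ⊎ (c , d) ∈⟨ (a , b) ⟩) → (a , b) ⋈ (c , d) ⊎ (c , d) ⋈ (a , b)
    incomparable⇒⋈ (a∈⟨g⟩ , b∈⟨h⟩) (c∈⟨g⟩ , d∈⟨h⟩) incomparable
      with A-chains a∈⟨g⟩ c∈⟨g⟩ | B-chains b∈⟨h⟩ d∈⟨h⟩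
    ... | inj₁ a∈⟨c⟩ | inj₁ b∈⟨d⟩ = ⊥-elim (incomparable (inj₁ (∈⟨⟩-pair a∈⟨c⟩ b∈⟨d⟩)))
    ... | inj₂ c∈⟨a⟩ | inj₂ d∈⟨b⟩ = ⊥-elim (incomparable (inj₂ (∈⟨⟩-pair c∈⟨a⟩ d∈⟨b⟩)))
    ... | inj₁ a∈⟨c⟩ | inj₂ d∈⟨b⟩ = inj₁ (crossing⇒⋈ a∈⟨c⟩ d∈⟨b⟩ incomparable)
    ... | inj₂ c∈⟨a⟩ | inj₁ b∈⟨d⟩ = inj₂ (crossing⇒⋈ c∈⟨a⟩ b∈⟨d⟩ (incomparable ∘ Sum.swap))

    DiffAdj⇒⋈ : ∀ {x y} → DiffAdj G x y → x ⋈ y ⊎ y ⋈ x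
    DiffAdj⇒⋈ ((x≉y , (g , h) , x∈⟨gh⟩ , y∈⟨gh⟩) , ¬x—y) =
      incomparable⇒⋈ (∈⟨⟩-proj (InCyc⇒∈⟨⟩ x∈⟨gh⟩)) (∈⟨⟩-proj (InCyc⇒∈⟨⟩ y∈⟨gh⟩))
        (λ comparable → ¬x—y (x≉y , Sum.map ∈⟨⟩⇒InCyc ∈⟨⟩⇒InCyc comparable))

lemma3p10 : (p q : ℕ) → Prime p → Prime q → ¬ (p ≡ q)
  → (P Q : AbelianGroup 0ℓ 0ℓ) → IsFinitePGroup p P → IsFinitePGroup q Q
  → (X Y : AbelianGroup.Carrier (P ×ᴳ Q) → Set)
  → CompleteBipartiteSub (AbelianGroup.group (P ×ᴳ Q)) X Y
  → (a₁ : AbelianGroup.Carrier P) (b₁ : AbelianGroup.Carrier Q)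
  → (c₁ : AbelianGroup.Carrier P) (d₁ : AbelianGroup.Carrier Q)
  → X (a₁ , b₁) → Y (c₁ , d₁)
  → Dominates (AbelianGroup.group P) c₁ a₁ → Dominates (AbelianGroup.group Q) b₁ d₁
  → (a c : AbelianGroup.Carrier P) (b d : AbelianGroup.Carrier Q)
  → X (a , b) → Y (c , d)
  → Dominates (AbelianGroup.group P) c a × Dominates (AbelianGroup.group Q) b d
lemma3p10 _ _ p-prime q-prime p≢q P Q P-finite Q-finite X Y H _ _ _ _ x₁∈X y₁∈Y c₁↠a₁ b₁↠d₁ a c b d x∈X y∈Y =
  P′.↠⇒Dominates (proj₁ ab⋈cd) , Q′.↠⇒Dominates (proj₂ ab⋈cd)
  where
  module P′ = FiniteAbelianPGroup p-prime P P-finite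
  module Q′ = FiniteAbelianPGroup q-prime Q Q-finite
  open CoprimeProduct (AbelianGroup.group P) (AbelianGroup.group Q) P′.exponent Q′.exponent
         (coprime-prime^ p-prime q-prime p≢q P′.K Q′.K)
  open CompleteBipartiteSub H

  ab⋈cd : (a , b) ⋈ (c , d)
  ab⋈cd = complete-bipartite-oriented ⋈-trans
            (DiffAdj⇒⋈ P′.cyclicSubgroupsAreChains Q′.cyclicSubgroupsAreChains) ⋈⇒DiffAdj
            X-ind Y-ind XY x₁∈X y₁∈Y (P′.Dominates⇒↠ c₁↠a₁ , Q′.Dominates⇒↠ b₁↠d₁) x∈X y∈Y
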